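{- Suppose $0<\eta\ll\alpha,\ 1/2-\alpha<1/2$. Let $G$ be an $\eta$-extremal graph on $n$ vertices with $\delta(G)=(1/2+\alpha)n$, and let $A,B\subset V(G)$ be disjoint sets witnessing this, i.e. satisfying (E1)–(E4). Then: (i) every vertex $v\in B$ satisfies $d_B(v)\ge(\alpha+\sqrt{\alpha/2}-3\eta)n$; (ii) all but at most $2\sqrt{\eta}n$ vertices $v\in B$ satisfy $d_B(v)\le(\alpha+\sqrt{\alpha/2}+2\sqrt{\eta})n$.
   Context: Hierarchy convention: a statement "holds whenever $0<a\ll b\ll c$" means there are non-decreasing functions $f,g$ such that it holds for all $b\le f(c)$, $a\le g(b)$ (and similarly for longer chains, with $1/n$ also allowed as a parameter). $x_+:=\max\{x,0\}$. Definition: Let $\eta>0$, $-1/2\le\alpha\le1/2$, and let $G$ be a graph on $n$ vertices with $\delta(G)=(1/2+\alpha)n$. $G$ is $\eta$-extremal if there exist disjoint $A,B\subset V(G)$ with (E1) $|A|=(1/2-\sqrt{\alpha_+/2}\pm\eta)n$; (E2) $|B|=(1/2+\sqrt{\alpha_+/2}\pm\eta)n$; (E3) $e(A,B)>(1-\eta)|A||B|$; (E4) $e(B)<(\alpha_++\sqrt{\alpha_+/2}+\eta)n|B|/2$. Here $a=x\pm\epsilon$ means $x-\epsilon\le a\le x+\epsilon$, $e(A,B)$ counts edges between $A$ and $B$, $e(B)$ counts edges inside $B$, and $d_B(v)$ is the number of neighbours of $v$ in $B$.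
   Formalization: The parameter η ranges over the positive rationals. -}

module Defs where

open import Data.Nat using (ℕ; zero; suc)
import Data.Nat as ℕ
open import Data.Bool using (Bool; true; false; if_then_else_; _∧_; T)
open import Data.Fin using (Fin; toℕ) renaming (zero to fzero; suc to fsuc)
open import Data.Fin.Subset using (Subset; _∈_; _∉_; _⊆_; ∣_∣)
open import Data.Vec using (lookup; tabulate)
open import Data.Integer using (+_)
open import Data.Rational using (ℚ; _/_; _+_; _-_; _*_; _≤_; _<_; 0ℚ)
open import Data.Product using (_×_; Σ)
open import Data.Sum using (_⊎_)
open import Relation.Binary.PropositionalEquality using (_≡_)
open import Relation.Nullary using (¬_)

record Graph (n : ℕ) : Set where
  field
    adj    : Fin n → Fin n → Bool
    sym    : ∀ u v → adj u v ≡ adj v u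
    irrefl : ∀ v → adj v v ≡ false
open Graph public

ℕ→ℚ : ℕ → ℚ
ℕ→ℚ k = + k / 1

ind : Bool → ℕ
ind b = if b then 1 else 0

sumFin : ∀ {n} → (Fin n → ℕ) → ℕ
sumFin {zero}  f = 0
sumFin {suc n} f = f fzero ℕ.+ sumFin (λ i → f (fsuc i))

module _ {n : ℕ} (G : Graph n) where

  N : Fin n → Subset n
  N v = tabulate (adj G v)

  dIn : Subset n → Fin n → ℕ
  dIn X v = sumFin λ u → ind (lookup X u ∧ adj G v u)

  deg : Fin n → ℕ
  deg v = ∣ N v ∣

  -- δ(G) = d : d is the minimum degree (this forces n ≥ 1)
  IsMinDegree : ℕ → Set
  IsMinDegree d = (∀ v → d ℕ.≤ deg v) × Σ (Fin n) (λ v → deg v ≡ d)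

  -- e(X,Y): number of pairs (x,y) ∈ X × Y with xy an edge
  -- (= number of edges between X and Y when X,Y are disjoint)
  eBetween : Subset n → Subset n → ℕ
  eBetween X Y = sumFin λ u → sumFin λ v → ind (lookup X u ∧ lookup Y v ∧ adj G u v)

  eIn : Subset n → ℕ
  eIn X = sumFin λ u → sumFin λ v →
            ind (lookup X u ∧ lookup X v ∧ adj G u v ∧ (toℕ u ℕ.<ᵇ toℕ v))

Disjoint : ∀ {n} → Subset n → Subset n → Set
Disjoint {n} A B = ∀ (v : Fin n) → v ∈ A → v ∉ B

-- There are no reals in the library; these are exact encodings of the
-- real-number inequalities, valid whenever the radicands are ≥ 0.

_≤√_ : ℚ → ℚ → Set
x ≤√ r = x ≤ 0ℚ ⊎ x * x ≤ r

_<√_ : ℚ → ℚ → Set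
x <√ r = x < 0ℚ ⊎ x * x < r

√_≤_ : ℚ → ℚ → Set
√ r ≤ x = 0ℚ ≤ x × r ≤ x * x

-- x ≤ √r + √s   ⇔   x ≤ 0  or  x² ≤ r + s + 2√(rs)  ⇔  x ≤ 0 or x² - r - s ≤ √(4rs)
LeSqrtSum : ℚ → ℚ → ℚ → Set
LeSqrtSum x r s = x ≤ 0ℚ ⊎ (x * x - r - s) ≤√ ((+ 4 / 1) * r * s)

module Submission where

-- (i) is inclusion–exclusion, d_B(v) ≥ d(v) + |B| − n ≥ δ + |B| − n, combined with the lower bound on |B|
-- in (E2).  For (ii) let S be the set of v ∈ B whose excess d_B(v) − αn − (|B| − (1/2 + η)n) is larger than
-- 2√η n; outside S the bound holds because |B| − (1/2 + η)n ≤ √(α/2) n by (E2).  Every vertex of B has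
-- d_B(v) ≥ δ + |B| − n and every vertex of S exceeds this by more than 2√η n − ηn, while by (E4)
-- Σ_{v∈B} d_B(v) = 2e(B) < |B|(δ + |B| − n + 2ηn) (using (E2) once more).  Hence |S|(2√η n − ηn) < 2ηn|B|, i.e.
-- 2√η n |S| < ηn(|S| + 2|B|) ≤ 4ηn², so |S| < 2√η n.  No square root is ever formed: comparisons with √r
-- are squared, and the last inequality is multiplied by |S| instead of divided by 2√η n.

open import Defs hiding (sym)

module Counting where
  open import Data.Nat as ℕ using (ℕ; zero; suc; _+_; _*_; _≤_; z≤n)
  import Data.Nat.Properties as ℕ
  open import Data.Bool using (Bool; true; false; _∧_)
  open import Data.Bool.Properties using (∧-assoc; ∧-comm; ∧-zeroʳ; ∧-identityʳ)
  open import Data.Fin using (Fin; toℕ) renaming (zero to fzero; suc to fsuc)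
  open import Data.Fin.Properties using (toℕ-injective)
  open import Data.Fin.Subset using (Subset; ∣_∣)
  open import Data.Vec using ([]; _∷_; lookup)
  open import Data.Vec.Properties using (lookup∘tabulate)
  open import Relation.Binary.Definitions using (tri<; tri≈; tri>)
  open import Relation.Binary.PropositionalEquality
  open import Relation.Nullary using (¬_)
  open import Relation.Nullary.Decidable using (dec-true; dec-false)
  open import Algebra.Properties.Semiring.Sum ℕ.+-*-semiring
    using (sum; sum-cong-≗; ∑-distrib-+; ∑-comm; *-distribˡ-sum)

  private
    sumFin≡sum : ∀ {n} (f : Fin n → ℕ) → sumFin f ≡ sum f
    sumFin≡sum {zero}  f = refl
    sumFin≡sum {suc n} f = cong (f fzero +_) (sumFin≡sum (λ i → f (fsuc i)))

    sum-mono-≤ : ∀ {n} {f g : Fin n → ℕ} → (∀ i → f i ≤ g i) → sum f ≤ sum g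
    sum-mono-≤ {zero}  f≤g = z≤n
    sum-mono-≤ {suc n} f≤g = ℕ.+-mono-≤ (f≤g fzero) (sum-mono-≤ (λ i → f≤g (fsuc i)))

    sum-1≡n : ∀ n → sum {n} (λ _ → 1) ≡ n
    sum-1≡n zero    = refl
    sum-1≡n (suc n) = cong suc (sum-1≡n n)

    ind-∧ : ∀ a b → ind a * ind b ≡ ind (a ∧ b)
    ind-∧ true  b = ℕ.+-identityʳ (ind b)
    ind-∧ false b = refl

    ind+ind≤ind-∧+1 : ∀ a b → ind a + ind b ≤ ind (b ∧ a) + 1
    ind+ind≤ind-∧+1 true  true  = ℕ.≤-refl
    ind+ind≤ind-∧+1 true  false = ℕ.≤-refl
    ind+ind≤ind-∧+1 false true  = ℕ.≤-refl
    ind+ind≤ind-∧+1 false false = z≤n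

  ∣p∣≡sum-ind : ∀ {n} (p : Subset n) → ∣ p ∣ ≡ sum (λ i → ind (lookup p i))
  ∣p∣≡sum-ind []          = refl
  ∣p∣≡sum-ind (true  ∷ p) = cong suc (∣p∣≡sum-ind p)
  ∣p∣≡sum-ind (false ∷ p) = ∣p∣≡sum-ind p

  module _ {n : ℕ} (r : Fin n → Fin n → Bool)
           (r-sym : ∀ u v → r u v ≡ r v u) (r-irrefl : ∀ u → r u u ≡ false) where

    private
      _≺_ : Fin n → Fin n → Bool
      u ≺ v = toℕ u ℕ.<ᵇ toℕ v

      ≺-true : ∀ {u v} → toℕ u ℕ.< toℕ v → u ≺ v ≡ true
      ≺-true = dec-true (_ ℕ.<? _)

      ≺-false : ∀ {u v} → ¬ toℕ u ℕ.< toℕ v → u ≺ v ≡ false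
      ≺-false = dec-false (_ ℕ.<? _)

      ind-split : ∀ u v → ind (r u v) ≡ ind (r u v ∧ u ≺ v) + ind (r v u ∧ v ≺ u)
      ind-split u v with ℕ.<-cmp (toℕ u) (toℕ v)
      ... | tri< u<v _ v≮u
        rewrite ≺-true u<v | ≺-false v≮u | ∧-identityʳ (r u v) | ∧-zeroʳ (r v u)
        = sym (ℕ.+-identityʳ _)
      ... | tri> u≮v _ v<u
        rewrite ≺-false u≮v | ≺-true v<u | ∧-zeroʳ (r u v) | ∧-identityʳ (r v u) | r-sym u v
        = refl
      ... | tri≈ _ u≡v _ with toℕ-injective u≡v
      ... | refl rewrite r-irrefl u = refl

    sum-ordered≡2*sum-unordered :
      sum (λ u → sum (λ v → ind (r u v)))
        ≡ 2 * sum (λ u → sum (λ v → ind (r u v ∧ (toℕ u ℕ.<ᵇ toℕ v))))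
    sum-ordered≡2*sum-unordered = begin
      sum (λ u → sum (λ v → ind (r u v)))
        ≡⟨ sum-cong-≗ (λ u → trans (sum-cong-≗ (ind-split u)) (∑-distrib-+ (h u) (λ v → h v u))) ⟩
      sum (λ u → sum (h u) + sum (λ v → h v u))
        ≡⟨ ∑-distrib-+ (λ u → sum (h u)) (λ u → sum (λ v → h v u)) ⟩
      H + sum (λ u → sum (λ v → h v u))
        ≡⟨ cong (H +_) (∑-comm (λ u v → h v u)) ⟩
      H + H
        ≡⟨ cong (H +_) (sym (ℕ.+-identityʳ H)) ⟩
      2 * H ∎
      where
      open ≡-Reasoning
      h : Fin n → Fin n → ℕ
      h u v = ind (r u v ∧ u ≺ v)
      H : ℕ
      H = sum (λ u → sum (h u))

  module _ {n : ℕ} (G : Graph n) where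

    private
      deg≡sum : ∀ v → deg G v ≡ sum (λ u → ind (adj G v u))
      deg≡sum v = trans (∣p∣≡sum-ind (N G v)) (sum-cong-≗ (λ u → cong ind (lookup∘tabulate (adj G v) u)))

    deg+∣X∣≤dIn+n : ∀ X v → deg G v + ∣ X ∣ ≤ dIn G X v + n
    deg+∣X∣≤dIn+n X v = begin
      deg G v + ∣ X ∣
        ≡⟨ cong₂ _+_ (deg≡sum v) (∣p∣≡sum-ind X) ⟩
      sum (λ u → ind (adj G v u)) + sum (λ u → ind (lookup X u))
        ≡⟨ ∑-distrib-+ (λ u → ind (adj G v u)) (λ u → ind (lookup X u)) ⟨
      sum (λ u → ind (adj G v u) + ind (lookup X u))
        ≤⟨ sum-mono-≤ (λ u → ind+ind≤ind-∧+1 (adj G v u) (lookup X u)) ⟩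
      sum (λ u → ind (lookup X u ∧ adj G v u) + 1)
        ≡⟨ ∑-distrib-+ (λ u → ind (lookup X u ∧ adj G v u)) (λ _ → 1) ⟩
      sum (λ u → ind (lookup X u ∧ adj G v u)) + sum {n} (λ _ → 1)
        ≡⟨ cong₂ _+_ (sym (sumFin≡sum (λ u → ind (lookup X u ∧ adj G v u)))) (sum-1≡n n) ⟩
      dIn G X v + n ∎
      where open ℕ.≤-Reasoning

    sum-dIn≡2*eIn : ∀ X → sum (λ v → ind (lookup X v) * dIn G X v) ≡ 2 * eIn G X
    sum-dIn≡2*eIn X = begin
      sum (λ v → ind (lookup X v) * dIn G X v)
        ≡⟨ sum-cong-≗ (λ v → trans (cong (ind (lookup X v) *_) (sumFin≡sum (inX∧adj v)))
                                   (*-distribˡ-sum (ind (lookup X v)) (inX∧adj v))) ⟩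
      sum (λ v → sum (λ u → ind (lookup X v) * inX∧adj v u))
        ≡⟨ sum-cong-≗ (λ v → sum-cong-≗ (λ u →
             trans (ind-∧ (lookup X v) _) (cong ind (sym (∧-assoc (lookup X v) (lookup X u) _))))) ⟩
      sum (λ v → sum (λ u → ind (r v u)))
        ≡⟨ sum-ordered≡2*sum-unordered r r-sym r-irrefl ⟩
      2 * sum (λ u → sum (λ v → ind (r u v ∧ (toℕ u ℕ.<ᵇ toℕ v))))
        ≡⟨ cong (2 *_) (sum-cong-≗ (λ u → sum-cong-≗ (λ v →
             cong ind (∧-assoc₃ (lookup X u) (lookup X v) _ _)))) ⟩
      2 * sum (λ u → sum (edge< u))
        ≡⟨ cong (2 *_) (trans (sumFin≡sum (λ u → sumFin (edge< u)))
                              (sum-cong-≗ (λ u → sumFin≡sum (edge< u)))) ⟨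
      2 * eIn G X ∎
      where
      open ≡-Reasoning
      inX∧adj : Fin n → Fin n → ℕ
      inX∧adj v u = ind (lookup X u ∧ adj G v u)
      edge< : Fin n → Fin n → ℕ
      edge< u v = ind (lookup X u ∧ lookup X v ∧ adj G u v ∧ (toℕ u ℕ.<ᵇ toℕ v))
      r : Fin n → Fin n → Bool
      r u v = (lookup X u ∧ lookup X v) ∧ adj G u v
      r-sym : ∀ u v → r u v ≡ r v u
      r-sym u v = cong₂ _∧_ (∧-comm (lookup X u) (lookup X v)) (Graph.sym G u v)
      r-irrefl : ∀ u → r u u ≡ false
      r-irrefl u = trans (cong ((lookup X u ∧ lookup X u) ∧_) (irrefl G u)) (∧-zeroʳ _)
      ∧-assoc₃ : ∀ a b c d → ((a ∧ b) ∧ c) ∧ d ≡ a ∧ b ∧ c ∧ d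
      ∧-assoc₃ a b c d = trans (∧-assoc (a ∧ b) c d) (∧-assoc a b (c ∧ d))

open Counting

open import Data.Nat as ℕ using (ℕ; zero; suc)
import Data.Nat.Properties as ℕ
import Data.Nat.Coprimality as Coprime
import Data.Integer as ℤ
import Data.Integer.Properties as ℤ
open import Data.Integer using (+_)
open import Data.Rational
  using (ℚ; mkℚ; _/_; -_; _+_; _-_; _*_; _≤_; _<_; *≤*; 0ℚ; ½; 1ℚ; nonNegative; positive)
open import Data.Rational.Properties
open import Data.Rational.Solver using (module +-*-Solver)
open import Data.Bool using (true; false; _∧_)
open import Data.Bool.Properties using (∧-conicalˡ; ∧-conicalʳ; T-≡)
open import Data.Fin using (Fin) renaming (zero to fzero; suc to fsuc)
open import Data.Fin.Subset using (Subset; _∈_; _∉_; _⊆_; ∣_∣)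
open import Data.Fin.Subset.Properties using (∣p∣≤n)
open import Data.Vec using (lookup; tabulate)
open import Data.Vec.Properties using (lookup∘tabulate; []=⇒lookup; lookup⇒[]=)
open import Data.Product using (Σ; _×_; _,_; proj₁; proj₂; ∃)
open import Data.Sum using (inj₁; inj₂)
open import Data.Empty using (⊥-elim)
open import Function using (_∘_; Equivalence)
open import Level using (Level)
open import Relation.Nullary using (¬_; Dec; yes; no)
open import Relation.Nullary.Decidable
  using (⌊_⌋; _⊎-dec_; ¬?; toWitness; fromWitness; decidable-stable)
open import Relation.Unary using (Pred; Decidable)
open import Relation.Binary.PropositionalEquality
open import Algebra.Bundles using (Ring)
open import Algebra.Properties.Semiring.Sum ℕ.+-*-semiring as ℕΣ using ()
open import Algebra.Properties.Semiring.Sum (Ring.semiring +-*-ring)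
  using (sum; sum-cong-≗; ∑-distrib-+; *-distribˡ-sum)
open +-*-Solver

private
  ℕ→ℚ≡mkℚ : ∀ a → ℕ→ℚ a ≡ mkℚ (+ a) 0 (Coprime.sym (Coprime.1-coprimeTo a))
  ℕ→ℚ≡mkℚ a = normalize-coprime (Coprime.sym (Coprime.1-coprimeTo a))

ℕ→ℚ-+ : ∀ a b → ℕ→ℚ (a ℕ.+ b) ≡ ℕ→ℚ a + ℕ→ℚ b
ℕ→ℚ-+ a b rewrite ℕ→ℚ≡mkℚ a | ℕ→ℚ≡mkℚ b =
  /-cong {p₁ = + (a ℕ.+ b)} (sym (cong₂ ℤ._+_ (ℤ.*-identityʳ (+ a)) (ℤ.*-identityʳ (+ b)))) refl

ℕ→ℚ-* : ∀ a b → ℕ→ℚ (a ℕ.* b) ≡ ℕ→ℚ a * ℕ→ℚ b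
ℕ→ℚ-* a b rewrite ℕ→ℚ≡mkℚ a | ℕ→ℚ≡mkℚ b = /-cong {p₁ = + (a ℕ.* b)} (ℤ.pos-* a b) refl

ℕ→ℚ-mono-≤ : ∀ {a b} → a ℕ.≤ b → ℕ→ℚ a ≤ ℕ→ℚ b
ℕ→ℚ-mono-≤ {a} {b} a≤b rewrite ℕ→ℚ≡mkℚ a | ℕ→ℚ≡mkℚ b = *≤* (ℤ.*-monoʳ-≤-nonNeg (+ 1) (ℤ.+≤+ a≤b))

0≤ℕ→ℚ : ∀ a → 0ℚ ≤ ℕ→ℚ a
0≤ℕ→ℚ a = ℕ→ℚ-mono-≤ {0} {a} ℕ.z≤n

ℕ→ℚ-sum : ∀ {n} (f : Fin n → ℕ) → ℕ→ℚ (ℕΣ.sum f) ≡ sum (ℕ→ℚ ∘ f)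
ℕ→ℚ-sum {zero}  f = refl
ℕ→ℚ-sum {suc n} f = trans (ℕ→ℚ-+ (f fzero) _) (cong (_+_ (ℕ→ℚ (f fzero))) (ℕ→ℚ-sum (f ∘ fsuc)))

sum-mono-≤ : ∀ {n} {f g : Fin n → ℚ} → (∀ i → f i ≤ g i) → sum f ≤ sum g
sum-mono-≤ {zero}  f≤g = ≤-refl
sum-mono-≤ {suc n} f≤g = +-mono-≤ (f≤g fzero) (sum-mono-≤ (f≤g ∘ fsuc))

private
  y-x+x≡y : ∀ x y → (y - x) + x ≡ y
  y-x+x≡y = solve 2 (λ x y → (y :- x) :+ x := y) refl

≤-by-difference : ∀ {x y} c → y - x ≡ c → 0ℚ ≤ c → x ≤ y
≤-by-difference {x} {y} c refl 0≤c = subst₂ _≤_ (+-identityˡ x) (y-x+x≡y x y) (+-monoˡ-≤ x 0≤c)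

<-by-difference : ∀ {x y} c → y - x ≡ c → 0ℚ < c → x < y
<-by-difference {x} {y} c refl 0<c = subst₂ _<_ (+-identityˡ x) (y-x+x≡y x y) (+-monoˡ-< x 0<c)

0≤-difference : ∀ {x y} → x ≤ y → 0ℚ ≤ y - x
0≤-difference {x} {y} x≤y = subst (_≤ y - x) (+-inverseʳ x) (+-monoˡ-≤ (- x) x≤y)

0<-difference : ∀ {x y} → x < y → 0ℚ < y - x
0<-difference {x} {y} x<y = subst (_< y - x) (+-inverseʳ x) (+-monoˡ-< (- x) x<y)

*-nonNeg : ∀ {a b} → 0ℚ ≤ a → 0ℚ ≤ b → 0ℚ ≤ a * b
*-nonNeg {a} {b} 0≤a 0≤b =
  nonNegative⁻¹ _ {{nonNeg*nonNeg⇒nonNeg a {{nonNegative 0≤a}} b {{nonNegative 0≤b}}}}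

*-pos : ∀ {a b} → 0ℚ < a → 0ℚ < b → 0ℚ < a * b
*-pos {a} {b} 0<a 0<b = positive⁻¹ _ {{pos*pos⇒pos a {{positive 0<a}} b {{positive 0<b}}}}

*-mono-≤-nonNeg : ∀ {a b c d} → 0ℚ ≤ a → a ≤ b → 0ℚ ≤ c → c ≤ d → a * c ≤ b * d
*-mono-≤-nonNeg {a} {b} {c} {d} 0≤a a≤b 0≤c c≤d =
  ≤-trans (*-monoʳ-≤-nonNeg c {{nonNegative 0≤c}} a≤b)
          (*-monoˡ-≤-nonNeg b {{nonNegative (≤-trans 0≤a a≤b)}} c≤d)

square-mono-≤ : ∀ {a b} → 0ℚ ≤ a → a ≤ b → a * a ≤ b * b
square-mono-≤ 0≤a a≤b = *-mono-≤-nonNeg 0≤a a≤b 0≤a a≤b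

√_<_ : ℚ → ℚ → Set
√ r < x = 0ℚ < x × r < x * x

_≤√?_ : ∀ x r → Dec (x ≤√ r)
x ≤√? r = (x ≤? 0ℚ) ⊎-dec (x * x ≤? r)

≰√⇒√< : ∀ {x r} → ¬ (x ≤√ r) → √ r < x
≰√⇒√< x≰√r = ≰⇒> (x≰√r ∘ inj₁) , ≰⇒> (x≰√r ∘ inj₂)

√≤-weaken : ∀ {r x y} → √ r ≤ x → x ≤ y → √ r ≤ y
√≤-weaken (0≤x , r≤x²) x≤y = ≤-trans 0≤x x≤y , ≤-trans r≤x² (square-mono-≤ 0≤x x≤y)

≤√-weaken : ∀ {x y r} → x ≤ y → y ≤√ r → x ≤√ r
≤√-weaken x≤y (inj₁ y≤0) = inj₁ (≤-trans x≤y y≤0)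
≤√-weaken {x} x≤y (inj₂ y²≤r) with x ≤? 0ℚ
... | yes x≤0 = inj₁ x≤0
... | no x≰0  = inj₂ (≤-trans (square-mono-≤ (<⇒≤ (≰⇒> x≰0)) x≤y) y²≤r)

≤√-witness : ∀ {x r} → 0ℚ ≤ r → x ≤√ r → ∃ λ y → 0ℚ ≤ y × x ≤ y × y * y ≤ r
≤√-witness 0≤r (inj₁ x≤0) = 0ℚ , ≤-refl , x≤0 , 0≤r
≤√-witness {x} 0≤r (inj₂ x²≤r) with ≤-total 0ℚ x
... | inj₁ 0≤x = x , 0≤x , ≤-refl , x²≤r
... | inj₂ x≤0 = 0ℚ , ≤-refl , x≤0 , 0≤r

<√⇒< : ∀ {x r z} → x <√ r → r ≤ z * z → 0ℚ ≤ z → x < z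
<√⇒< (inj₁ x<0) _ 0≤z = <-≤-trans x<0 0≤z
<√⇒< {x} {z = z} (inj₂ x²<r) r≤z² 0≤z with x <? z
... | yes x<z = x<z
... | no x≮z  = ⊥-elim (<-irrefl refl (<-≤-trans x²<r (≤-trans r≤z² (square-mono-≤ 0≤z (≮⇒≥ x≮z)))))

√<-* : ∀ {r x y} → √ r < x → √ r < y → r < x * y
√<-* {x = x} {y} (0<x , r<x²) (0<y , r<y²) with ≤-total x y
... | inj₁ x≤y = <-≤-trans r<x² (*-monoˡ-≤-nonNeg x {{nonNegative (<⇒≤ 0<x)}} x≤y)
... | inj₂ y≤x = <-≤-trans r<y² (*-monoʳ-≤-nonNeg y {{nonNegative (<⇒≤ 0<y)}} y≤x)

≤√+≤√ : ∀ {x y r s} → 0ℚ ≤ r → 0ℚ ≤ s → x ≤√ r → y ≤√ s → LeSqrtSum (x + y) r s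
≤√+≤√ {x} {y} {r} {s} 0≤r 0≤s x≤√r y≤√s with (x + y) ≤? 0ℚ | ≤√-witness 0≤r x≤√r | ≤√-witness 0≤s y≤√s
... | yes x+y≤0 | _ | _ = inj₁ x+y≤0
... | no x+y≰0 | x' , 0≤x' , x≤x' , x'²≤r | y' , 0≤y' , y≤y' , y'²≤s =
  inj₂ (≤√-weaken excess≤2x'y'
    (inj₂ (subst₂ _≤_ (sym square-2x'y') (sym (*-assoc (+ 4 / 1) r s)) 4x'²y'²≤4rs)))
  where
  [x+y]²≤[x'+y']² : (x + y) * (x + y) ≤ (x' + y') * (x' + y')
  [x+y]²≤[x'+y']² = square-mono-≤ (<⇒≤ (≰⇒> x+y≰0)) (+-mono-≤ x≤x' y≤y')
  excess≤2x'y' : (x + y) * (x + y) - r - s ≤ (+ 2 / 1) * x' * y'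
  excess≤2x'y' = ≤-by-difference _
    (solve 5 (λ x' y' r s z → con (+ 2 / 1) :* x' :* y' :- (z :- r :- s)
             := ((x' :+ y') :* (x' :+ y') :- z) :+ (r :- x' :* x') :+ (s :- y' :* y'))
           refl x' y' r s ((x + y) * (x + y)))
    (+-mono-≤ (+-mono-≤ (0≤-difference [x+y]²≤[x'+y']²) (0≤-difference x'²≤r)) (0≤-difference y'²≤s))
  square-2x'y' : ((+ 2 / 1) * x' * y') * ((+ 2 / 1) * x' * y') ≡ (+ 4 / 1) * ((x' * x') * (y' * y'))
  square-2x'y' = solve 2 (λ x' y' → (con (+ 2 / 1) :* x' :* y') :* (con (+ 2 / 1) :* x' :* y')
                                   := con (+ 4 / 1) :* ((x' :* x') :* (y' :* y'))) refl x' y'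
  4x'²y'²≤4rs : (+ 4 / 1) * ((x' * x') * (y' * y')) ≤ (+ 4 / 1) * (r * s)
  4x'²y'²≤4rs = *-monoˡ-≤-nonNeg (+ 4 / 1)
    (*-mono-≤-nonNeg (*-nonNeg 0≤x' 0≤x') x'²≤r (*-nonNeg 0≤y' 0≤y') y'²≤s)

module _ {ℓ : Level} {n : ℕ} {P : Pred (Fin n) ℓ} (P? : Decidable P) where

  select : Subset n → Subset n
  select X = tabulate (λ v → lookup X v ∧ ⌊ P? v ⌋)

  private
    ∈-select⇒ : ∀ {X v} → v ∈ select X → lookup X v ∧ ⌊ P? v ⌋ ≡ true
    ∈-select⇒ {X} {v} v∈ = trans (sym (lookup∘tabulate _ v)) ([]=⇒lookup v∈)

  select-⊆ : ∀ {X} → select X ⊆ X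
  select-⊆ {X} {v} v∈ = lookup⇒[]= v X (∧-conicalˡ _ _ (∈-select⇒ {X} v∈))

  ∈-select⇒P : ∀ {X v} → v ∈ select X → P v
  ∈-select⇒P {X} {v} v∈ =
    toWitness {a? = P? v} (Equivalence.from T-≡ (∧-conicalʳ _ _ (∈-select⇒ {X} v∈)))

  ∉-select⇒¬P : ∀ {X v} → v ∈ X → v ∉ select X → ¬ P v
  ∉-select⇒¬P {X} {v} v∈X v∉ Pv = v∉ (lookup⇒[]= v (select X)
    (trans (lookup∘tabulate _ v) (cong₂ _∧_ ([]=⇒lookup v∈X) (Equivalence.to T-≡ (fromWitness Pv)))))

𝟙 : ∀ {n} → Subset n → Fin n → ℚ
𝟙 X v = ℕ→ℚ (ind (lookup X v))

ℕ→ℚ∣X∣≡sum-𝟙 : ∀ {n} (X : Subset n) → ℕ→ℚ ∣ X ∣ ≡ sum (𝟙 X)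
ℕ→ℚ∣X∣≡sum-𝟙 X = trans (cong ℕ→ℚ (∣p∣≡sum-ind X)) (ℕ→ℚ-sum (ind ∘ lookup X))

sumOver : ∀ {n} → Subset n → (Fin n → ℚ) → ℚ
sumOver X f = sum (λ v → 𝟙 X v * f v)

sumOver-threshold : ∀ {n} {X S : Subset n} {f : Fin n → ℚ} {c m : ℚ} → S ⊆ X →
  (∀ v → v ∈ X → c ≤ f v) → (∀ v → v ∈ S → c + m ≤ f v) →
  (c * ℕ→ℚ ∣ X ∣) + (m * ℕ→ℚ ∣ S ∣) ≤ sumOver X f
sumOver-threshold {X = X} {S} {f} {c} {m} S⊆X c≤f c+m≤f = begin
  (c * ℕ→ℚ ∣ X ∣) + (m * ℕ→ℚ ∣ S ∣)
    ≡⟨ cong₂ _+_ (cong (c *_) (ℕ→ℚ∣X∣≡sum-𝟙 X)) (cong (m *_) (ℕ→ℚ∣X∣≡sum-𝟙 S)) ⟩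
  c * sum (𝟙 X) + m * sum (𝟙 S)
    ≡⟨ cong₂ _+_ (*-distribˡ-sum c (𝟙 X)) (*-distribˡ-sum m (𝟙 S)) ⟩
  sum (λ v → c * 𝟙 X v) + sum (λ v → m * 𝟙 S v)
    ≡⟨ ∑-distrib-+ (λ v → c * 𝟙 X v) (λ v → m * 𝟙 S v) ⟨
  sum (λ v → c * 𝟙 X v + m * 𝟙 S v)
    ≤⟨ sum-mono-≤ pointwise ⟩
  sumOver X f ∎
  where
  open ≤-Reasoning
  pointwise : ∀ v → c * 𝟙 X v + m * 𝟙 S v ≤ 𝟙 X v * f v
  pointwise v with lookup X v in v∈X? | lookup S v in v∈S?
  ... | true  | true  = subst₂ _≤_ (cong₂ _+_ (sym (*-identityʳ c)) (sym (*-identityʳ m)))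
                          (sym (*-identityˡ (f v))) (c+m≤f v (lookup⇒[]= v S v∈S?))
  ... | true  | false = subst₂ _≤_
                          (trans (sym (+-identityʳ c)) (cong₂ _+_ (sym (*-identityʳ c)) (sym (*-zeroʳ m))))
                          (sym (*-identityˡ (f v))) (c≤f v (lookup⇒[]= v X v∈X?))
  ... | false | true  with () ← trans (sym v∈X?) ([]=⇒lookup (S⊆X (lookup⇒[]= v S v∈S?)))
  ... | false | false = ≤-reflexive (trans (cong₂ _+_ (*-zeroʳ c) (*-zeroʳ m)) (sym (*-zeroˡ (f v))))

module DegreesInB {n : ℕ} (G : Graph n) (B : Subset n) {α η : ℚ} {δ : ℕ}
  (0≤α : 0ℚ ≤ α) (0≤η : 0ℚ ≤ η)
  (δ≤deg : ∀ v → δ ℕ.≤ deg G v) (δ≡ : ℕ→ℚ δ ≡ (½ + α) * ℕ→ℚ n)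
  (E2⁻ : √ (α * ℕ→ℚ n * ℕ→ℚ n * (+ 1 / 2)) ≤ (ℕ→ℚ ∣ B ∣ - (½ - η) * ℕ→ℚ n))
  (E2⁺ : (ℕ→ℚ ∣ B ∣ - (½ + η) * ℕ→ℚ n) ≤√ (α * ℕ→ℚ n * ℕ→ℚ n * (+ 1 / 2)))
  (E4 : (ℕ→ℚ (eIn G B) - (α + η) * ℕ→ℚ n * ℕ→ℚ ∣ B ∣ * ½)
          <√ (α * (+ 1 / 8) * ℕ→ℚ n * ℕ→ℚ n * ℕ→ℚ ∣ B ∣ * ℕ→ℚ ∣ B ∣))
  where

  nℚ bℚ eℚ : ℚ
  nℚ = ℕ→ℚ n
  bℚ = ℕ→ℚ ∣ B ∣
  eℚ = ℕ→ℚ (eIn G B)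

  d : Fin n → ℚ
  d v = ℕ→ℚ (dIn G B v)

  -- √R = √(α/2) n and √T = 2 √η n.
  R T : ℚ
  R = α * nℚ * nℚ * (+ 1 / 2)
  T = (+ 4 / 1) * η * nℚ * nℚ

  d-min : ℚ
  d-min = (½ + α) * nℚ + bℚ - nℚ

  d-min≤d : ∀ v → d-min ≤ d v
  d-min≤d v = ≤-by-difference _
    (solve 4 (λ dv x b n → dv :- (x :+ b :- n) := (dv :+ n) :- (x :+ b)) refl (d v) ((½ + α) * nℚ) bℚ nℚ)
    (0≤-difference δ+∣B∣≤d+n)
    where
    δ+∣B∣≤d+n : (½ + α) * nℚ + bℚ ≤ d v + nℚ
    δ+∣B∣≤d+n = subst₂ _≤_ (trans (ℕ→ℚ-+ δ ∣ B ∣) (cong (_+ bℚ) δ≡)) (ℕ→ℚ-+ (dIn G B v) n)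
      (ℕ→ℚ-mono-≤ (ℕ.≤-trans (ℕ.+-monoˡ-≤ ∣ B ∣ (δ≤deg v)) (deg+∣X∣≤dIn+n G B v)))

  d-lower : ∀ v → √ R ≤ (d v - (α - (+ 3 / 1) * η) * nℚ)
  d-lower v = √≤-weaken E2⁻ (≤-by-difference _
    (solve 5 (λ dv b n α η → (dv :- (α :- con (+ 3 / 1) :* η) :* n) :- (b :- (con ½ :- η) :* n)
                          := (dv :- ((con ½ :+ α) :* n :+ b :- n)) :+ con (+ 2 / 1) :* η :* n)
           refl (d v) bℚ nℚ α η)
    (+-mono-≤ (0≤-difference (d-min≤d v)) (*-nonNeg (*-nonNeg (0≤ℕ→ℚ 2) 0≤η) (0≤ℕ→ℚ n))))

  0≤R : 0ℚ ≤ R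
  0≤R = *-nonNeg (*-nonNeg (*-nonNeg 0≤α (0≤ℕ→ℚ n)) (0≤ℕ→ℚ n)) (nonNegative⁻¹ (+ 1 / 2))

  0≤T : 0ℚ ≤ T
  0≤T = *-nonNeg (*-nonNeg (*-nonNeg (0≤ℕ→ℚ 4) 0≤η) (0≤ℕ→ℚ n)) (0≤ℕ→ℚ n)

  excess : Fin n → ℚ
  excess v = d v - α * nℚ - (bℚ - (½ + η) * nℚ)

  excessive? : Decidable (λ v → ¬ (excess v ≤√ T))
  excessive? v = ¬? (excess v ≤√? T)

  S : Subset n
  S = select excessive? B

  S⊆B : S ⊆ B
  S⊆B = select-⊆ excessive? {B}

  d-upper : ∀ v → v ∈ B → v ∉ S → LeSqrtSum (d v - α * nℚ) R T
  d-upper v v∈B v∉S = subst (λ x → LeSqrtSum x R T)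
    (solve 5 (λ dv b n α η → (b :- (con ½ :+ η) :* n) :+ (dv :- α :* n :- (b :- (con ½ :+ η) :* n))
                          := dv :- α :* n) refl (d v) bℚ nℚ α η)
    (≤√+≤√ 0≤R 0≤T E2⁺ (decidable-stable (excess v ≤√? T) (∉-select⇒¬P excessive? v∈B v∉S)))

  2eℚ< : (+ 2 / 1) * eℚ < bℚ * (d-min + (+ 2 / 1) * η * nℚ)
  2eℚ< = <-by-difference _
    (solve 5 (λ e b n α η →
              b :* ((con ½ :+ α) :* n :+ b :- n :+ con (+ 2 / 1) :* η :* n) :- con (+ 2 / 1) :* e
           := con (+ 2 / 1) :* ((b :- (con ½ :- η) :* n) :* b :* con ½ :- (e :- (α :+ η) :* n :* b :* con ½)))
           refl eℚ bℚ nℚ α η)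
    (*-pos (positive⁻¹ (+ 2 / 1)) (0<-difference (<√⇒< E4 r≤z² 0≤z)))
    where
    p z : ℚ
    p = bℚ - (½ - η) * nℚ
    z = p * bℚ * ½
    0≤z : 0ℚ ≤ z
    0≤z = *-nonNeg (*-nonNeg (proj₁ E2⁻) (0≤ℕ→ℚ ∣ B ∣)) (nonNegative⁻¹ ½)
    r≤z² : α * (+ 1 / 8) * nℚ * nℚ * bℚ * bℚ ≤ z * z
    r≤z² = ≤-by-difference _
      (solve 4 (λ p b n α →
                (p :* b :* con ½) :* (p :* b :* con ½) :- α :* con (+ 1 / 8) :* n :* n :* b :* b
             := (p :* p :- α :* n :* n :* con (+ 1 / 2)) :* (b :* b :* con (+ 1 / 4)))
             refl p bℚ nℚ α)
      (*-nonNeg (0≤-difference (proj₂ E2⁻))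
                (*-nonNeg (*-nonNeg (0≤ℕ→ℚ ∣ B ∣) (0≤ℕ→ℚ ∣ B ∣)) (nonNegative⁻¹ (+ 1 / 4))))

  sumOver-scaled-d : ∀ s → sumOver B (λ v → s * d v) ≡ s * ((+ 2 / 1) * eℚ)
  sumOver-scaled-d s = begin
    sum (λ v → 𝟙 B v * (s * d v))
      ≡⟨ sum-cong-≗ (λ v →
           trans (solve 3 (λ i s d → i :* (s :* d) := s :* (i :* d)) refl (𝟙 B v) s (d v))
                 (cong (s *_) (sym (ℕ→ℚ-* (ind (lookup B v)) (dIn G B v))))) ⟩
    sum (λ v → s * ℕ→ℚ (degB v))
      ≡⟨ *-distribˡ-sum s (ℕ→ℚ ∘ degB) ⟨
    s * sum (ℕ→ℚ ∘ degB)
      ≡⟨ cong (s *_) (ℕ→ℚ-sum degB) ⟨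
    s * ℕ→ℚ (ℕΣ.sum degB)
      ≡⟨ cong (λ x → s * ℕ→ℚ x) (sum-dIn≡2*eIn G B) ⟩
    s * ℕ→ℚ (2 ℕ.* eIn G B)
      ≡⟨ cong (s *_) (ℕ→ℚ-* 2 (eIn G B)) ⟩
    s * ((+ 2 / 1) * eℚ) ∎
    where
    open ≡-Reasoning
    degB : Fin n → ℕ
    degB v = ind (lookup B v) ℕ.* dIn G B v

  ¬√T<∣S∣ : ¬ (√ T < ℕ→ℚ ∣ S ∣)
  ¬√T<∣S∣ √T<s@(0<s , _) = <-irrefl refl (<-≤-trans sum-upper (≤-trans slack sum-lower))
    where
    s : ℚ
    s = ℕ→ℚ ∣ S ∣
    sum-upper : s * ((+ 2 / 1) * eℚ) < s * (bℚ * (d-min + (+ 2 / 1) * η * nℚ))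
    sum-upper = *-monoʳ-<-pos s {{positive 0<s}} 2eℚ<
    slack : s * (bℚ * (d-min + (+ 2 / 1) * η * nℚ)) ≤ (s * d-min) * bℚ + (T - s * η * nℚ) * s
    slack = ≤-by-difference _
      (solve 5 (λ s dm b n η →
                  (s :* dm) :* b :+ (con (+ 4 / 1) :* η :* n :* n :- s :* η :* n) :* s
                  :- s :* (b :* (dm :+ con (+ 2 / 1) :* η :* n))
               := s :* η :* n :* ((n :- s) :+ con (+ 2 / 1) :* (n :- b) :+ n))
             refl s d-min bℚ nℚ η)
      (*-nonNeg (*-nonNeg (*-nonNeg (<⇒≤ 0<s) 0≤η) (0≤ℕ→ℚ n))
        (+-mono-≤ (+-mono-≤ (0≤-difference (ℕ→ℚ-mono-≤ (∣p∣≤n S)))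
                            (*-nonNeg (0≤ℕ→ℚ 2) (0≤-difference (ℕ→ℚ-mono-≤ (∣p∣≤n B)))))
                  (0≤ℕ→ℚ n)))
    lower-on-B : ∀ v → v ∈ B → s * d-min ≤ s * d v
    lower-on-B v _ = *-monoˡ-≤-nonNeg s {{nonNegative (<⇒≤ 0<s)}} (d-min≤d v)
    lower-on-S : ∀ v → v ∈ S → s * d-min + (T - s * η * nℚ) ≤ s * d v
    lower-on-S v v∈S = ≤-by-difference _
      (solve 6 (λ s dv b n α η →
                  s :* dv :- (s :* ((con ½ :+ α) :* n :+ b :- n) :+ (con (+ 4 / 1) :* η :* n :* n :- s :* η :* n))
               := s :* (dv :- α :* n :- (b :- (con ½ :+ η) :* n)) :- con (+ 4 / 1) :* η :* n :* n)
             refl s (d v) bℚ nℚ α η)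
      (0≤-difference (<⇒≤ (√<-* √T<s (≰√⇒√< (∈-select⇒P excessive? {B} v∈S)))))
    sum-lower : (s * d-min) * bℚ + (T - s * η * nℚ) * s ≤ s * ((+ 2 / 1) * eℚ)
    sum-lower = subst ((s * d-min) * bℚ + (T - s * η * nℚ) * s ≤_) (sumOver-scaled-d s)
      (sumOver-threshold {f = λ v → s * d v} {c = s * d-min} {m = T - s * η * nℚ}
                         S⊆B lower-on-B lower-on-S)

  ∣S∣≤√T : ℕ→ℚ ∣ S ∣ ≤√ T
  ∣S∣≤√T = decidable-stable (ℕ→ℚ ∣ S ∣ ≤√? T) (λ ∣S∣≰√T → ¬√T<∣S∣ (≰√⇒√< ∣S∣≰√T))

-- Neither bound needs η to be small, so f can be the identity.
lemma3p4 : Σ (ℚ → ℚ) λ f →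
    (∀ x y → 0ℚ < x → x ≤ y → f x ≤ f y) ×
    (∀ x → 0ℚ < x → 0ℚ < f x) ×
    (∀ (α η : ℚ) (n : ℕ) (G : Graph n) (δ : ℕ) (A B : Subset n) →
      0ℚ < α → α < ½ →
      0ℚ < η → η ≤ f α → η ≤ f (½ - α) →
      IsMinDegree G δ → ℕ→ℚ δ ≡ (½ + α) * ℕ→ℚ n →
      Disjoint A B →
      ((½ - η) * ℕ→ℚ n - ℕ→ℚ ∣ A ∣) ≤√ (α * ℕ→ℚ n * ℕ→ℚ n * (+ 1 / 2)) →
      √ (α * ℕ→ℚ n * ℕ→ℚ n * (+ 1 / 2)) ≤ ((½ + η) * ℕ→ℚ n - ℕ→ℚ ∣ A ∣) →
      √ (α * ℕ→ℚ n * ℕ→ℚ n * (+ 1 / 2)) ≤ (ℕ→ℚ ∣ B ∣ - (½ - η) * ℕ→ℚ n) →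
      (ℕ→ℚ ∣ B ∣ - (½ + η) * ℕ→ℚ n) ≤√ (α * ℕ→ℚ n * ℕ→ℚ n * (+ 1 / 2)) →
      (1ℚ - η) * ℕ→ℚ ∣ A ∣ * ℕ→ℚ ∣ B ∣ < ℕ→ℚ (eBetween G A B) →
      (ℕ→ℚ (eIn G B) - (α + η) * ℕ→ℚ n * ℕ→ℚ ∣ B ∣ * ½)
        <√ (α * (+ 1 / 8) * ℕ→ℚ n * ℕ→ℚ n * ℕ→ℚ ∣ B ∣ * ℕ→ℚ ∣ B ∣) →
      (∀ v → v ∈ B →
        √ (α * ℕ→ℚ n * ℕ→ℚ n * (+ 1 / 2))
          ≤ (ℕ→ℚ (dIn G B v) - (α - (+ 3 / 1) * η) * ℕ→ℚ n)) ×
      Σ (Subset n) λ S → S ⊆ B ×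
        (ℕ→ℚ ∣ S ∣ ≤√ ((+ 4 / 1) * η * ℕ→ℚ n * ℕ→ℚ n)) ×
        (∀ v → v ∈ B → v ∉ S →
          LeSqrtSum (ℕ→ℚ (dIn G B v) - α * ℕ→ℚ n)
                    (α * ℕ→ℚ n * ℕ→ℚ n * (+ 1 / 2))
                    ((+ 4 / 1) * η * ℕ→ℚ n * ℕ→ℚ n)))
lemma3p4 = (λ x → x) , (λ _ _ _ x≤y → x≤y) , (λ _ 0<x → 0<x) ,
  λ α η n G δ A B 0<α _ 0<η _ _ (δ≤deg , _) δ≡ _ _ _ E2⁻ E2⁺ _ E4 →
    let open DegreesInB G B (<⇒≤ 0<α) (<⇒≤ 0<η) δ≤deg δ≡ E2⁻ E2⁺ E4
    in (λ v _ → d-lower v) , S , S⊆B , ∣S∣≤√T , d-upper
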